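{- Let $\mathcal{M}_1=\mathcal{U}_{n_1,n_1}(q)$ (the free $q$-matroid on $\mathbb{F}_q^{n_1}$, represented by the identity matrix $I_{n_1}$), and let $\mathcal{M}_2=(\mathbb{F}_q^{n_2},\rho_2)$ be a $q$-matroid represented by $G_2\in\mathbb{F}_{q^m}^{k_2\times n_2}$, i.e. $\mathcal{M}_2=\mathcal{M}_{G_2}$. Then $\mathcal{M}_1\oplus\mathcal{M}_2$ is representable over $\mathbb{F}_{q^m}$, and a representing matrix is \[ G=\begin{pmatrix}I_{n_1}&0\\0&G_2\end{pmatrix}, \] i.e. $\mathcal{M}_1\oplus\mathcal{M}_2=\mathcal{M}_G$.
   Context: A $q$-matroid with ground space $E$ (a finite-dimensional $\mathbb{F}_q$-vector space) is a pair $(E,\rho)$ with $\rho$ from the subspaces of $E$ to $\mathbb{N}_{\ge0}$ satisfying $0\le\rho(V)\le\dim V$, monotonicity, and submodularity $\rho(V+W)+\rho(V\cap W)\le\rho(V)+\rho(W)$. $\mathcal{U}_{n,n}(q)$ is the $q$-matroid on $\mathbb{F}_q^n$ with $\rho(V)=\dim V$. For $G\in\mathbb{F}_{q^m}^{k\times n}$, $\mathcal{M}_G=(\mathbb{F}_q^n,\rho_G)$ with $\rho_G(V)=\operatorname{rk}_{\mathbb{F}_{q^m}}(GY^{\mathsf T})$ for any $\mathbb{F}_q$-matrix $Y$ with $n$ columns and row space $V$. A $q$-matroid on $\mathbb{F}_q^n$ is representable over $\mathbb{F}_{q^m}$ if it equals (has the same rank function as) $\mathcal{M}_G$ for some matrix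 $G$ over $\mathbb{F}_{q^m}$ with $n$ columns. Direct sum: for $q$-matroids $\mathcal{M}_i=(\mathbb{F}_q^{n_i},\rho_i)$ and $n=n_1+n_2$, write $\mathbb{F}_q^n=\mathbb{F}_q^{n_1}\oplus\mathbb{F}_q^{n_2}$ with $\pi_1,\pi_2$ the projections onto the first $n_1$ and last $n_2$ coordinates; put $\rho_i'(V)=\rho_i(\pi_i(V))$, $\mathcal{X}=\{X\le\mathbb{F}_q^n\mid\rho_1'(X)+\rho_2'(X)<\dim X\}$, $\mathcal{X}_0=\mathcal{X}\cup\{0\}$; then $\mathcal{M}_1\oplus\mathcal{M}_2=(\mathbb{F}_q^n,\rho)$ with $\rho(V)=\dim V+\min_{X\in\mathcal{X}_0,\,X\le V}(\rho_1'(X)+\rho_2'(X)-\dim X)$. -}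

module Defs where

open import Level using (Level; _⊔_)
open import Algebra.Bundles using (CommutativeRing)
open import Algebra.Morphism.Structures using (module RingMorphisms)
import Algebra.Definitions.RawMonoid as RawMonoidDefs
open import Data.Nat using (ℕ; _≤_; _<_; _+_)
open import Data.Fin using (Fin; _↑ˡ_; _↑ʳ_; splitAt; _≟_)
open import Data.Sum using (_⊎_; inj₁; inj₂)
open import Data.Product using (Σ; ∃; _×_; _,_)
open import Data.Bool using (if_then_else_)
open import Data.Integer as ℤ using (ℤ; +_)
open import Relation.Nullary using (¬_)
open import Relation.Nullary.Decidable using (⌊_⌋)
open import Relation.Binary.PropositionalEquality using (_≡_)

Matrix : ∀ {c} → Set c → ℕ → ℕ → Set c
Matrix A a b = Fin a → Fin b → A

module _ {c ℓ} (R : CommutativeRing c ℓ) where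
  open CommutativeRing R renaming (_+_ to _+ᴿ_)
  open RawMonoidDefs +-rawMonoid using (sum)

  IsField : Set (c ⊔ ℓ)
  IsField = (¬ (0# ≈ 1#)) × (∀ x → ¬ (x ≈ 0#) → ∃ λ y → x * y ≈ 1#)

  HasCardinality : ℕ → Set (c ⊔ ℓ)
  HasCardinality q = Σ (Fin q → Carrier) λ f →
    (∀ i j → f i ≈ f j → i ≡ j) × (∀ x → ∃ λ i → f i ≈ x)

  _⊙_ : ∀ {a b d} → Matrix Carrier a b → Matrix Carrier b d → Matrix Carrier a d
  (A ⊙ B) i j = sum (λ l → A i l * B l j)

  LinIndep : ∀ {r n} → Matrix Carrier r n → Set (c ⊔ ℓ)
  LinIndep {r} {n} v = ∀ (λ′ : Fin r → Carrier) →
    (∀ j → sum (λ i → λ′ i * v i j) ≈ 0#) → ∀ i → λ′ i ≈ 0#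

  HasRank : ∀ {a b} → Matrix Carrier a b → ℕ → Set (c ⊔ ℓ)
  HasRank {a} M d =
    (∃ λ (σ : Fin d → Fin a) → LinIndep (λ i → M (σ i))) ×
    (∀ s (σ : Fin s → Fin a) → LinIndep (λ i → M (σ i)) → s ≤ d)

  -- all entries zero (the row space is the zero subspace)
  IsZeroMatrix : ∀ {a b} → Matrix Carrier a b → Set ℓ
  IsZeroMatrix M = ∀ i j → M i j ≈ 0#

  identity : ∀ n → Matrix Carrier n n
  identity n i j = if ⌊ i ≟ j ⌋ then 1# else 0#

  blockDiag : ∀ {a₁ b₁ a₂ b₂} → Matrix Carrier a₁ b₁ → Matrix Carrier a₂ b₂ →
              Matrix Carrier (a₁ + a₂) (b₁ + b₂)
  blockDiag {a₁} {b₁} A B i j with splitAt a₁ i | splitAt b₁ j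
  ... | inj₁ i′ | inj₁ j′ = A i′ j′
  ... | inj₂ i′ | inj₂ j′ = B i′ j′
  ... | inj₁ _  | inj₂ _  = 0#
  ... | inj₂ _  | inj₁ _  = 0#

-- Column projections π₁, π₂ applied to the rows of a matrix
-- (row space of π₁ Y is π₁(row space of Y), likewise for π₂).
π₁ : ∀ {c} {A : Set c} {a n₁ n₂} → Matrix A a (n₁ + n₂) → Matrix A a n₁
π₁ {n₂ = n₂} Y i j = Y i (j ↑ˡ n₂)

π₂ : ∀ {c} {A : Set c} {a n₁ n₂} → Matrix A a (n₁ + n₂) → Matrix A a n₂
π₂ {n₁ = n₁} Y i j = Y i (n₁ ↑ʳ j)

module _ {c ℓ c′ ℓ′} (K : CommutativeRing c ℓ) (L : CommutativeRing c′ ℓ′) where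
  private
    module K = CommutativeRing K
    module L = CommutativeRing L
  open RawMonoidDefs L.+-rawMonoid using (sum)

  IsEmbedding : (K.Carrier → L.Carrier) → Set (c ⊔ ℓ ⊔ ℓ′)
  IsEmbedding ι = RingMorphisms.IsRingMonomorphism K.rawRing L.rawRing ι

  mulT : (K.Carrier → L.Carrier) → ∀ {k n r} →
         Matrix L.Carrier k n → Matrix K.Carrier r n → Matrix L.Carrier k r
  mulT ι G Y i l = sum (λ j → G i j L.* ι (Y l j))

  -- ρ_G(V) = t, where V is the row space of Y:  rk_L (G Yᵀ) = t.
  RankG : (K.Carrier → L.Carrier) → ∀ {k n r} →
          Matrix L.Carrier k n → Matrix K.Carrier r n → ℕ → Set (c′ ⊔ ℓ′)
  RankG ι G Y t = HasRank L (mulT ι G Y) t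

  -- The subspaces X ≤ V = rowsp(Y) are
  -- exactly the row spaces of the matrices Z = A Y (A over K, any number of rows).
  -- For such X:  dim X = rk Z,  ρ₁'(X) = dim π₁(X) = rk (π₁ Z),
  -- ρ₂'(X) = ρ_{G₂}(π₂ X) = rk_L (G₂ (π₂ Z)ᵀ).
  module DirectSum (ι : K.Carrier → L.Carrier) (n₁ n₂ k₂ : ℕ)
                   (G₂ : Matrix L.Carrier k₂ n₂) where

    Values : ∀ {s} → Matrix K.Carrier s (n₁ + n₂) → ℕ → ℕ → ℕ → Set (c ⊔ ℓ ⊔ c′ ⊔ ℓ′)
    Values Z d₁ d₂ dX =
      HasRank K (π₁ {n₁ = n₁} Z) d₁ × RankG ι G₂ (π₂ {n₁ = n₁} Z) d₂ × HasRank K Z dX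

    In𝒳₀ : ∀ {s} → Matrix K.Carrier s (n₁ + n₂) → ℕ → ℕ → ℕ → Set ℓ
    In𝒳₀ Z d₁ d₂ dX = IsZeroMatrix K Z ⊎ Lift′ (d₁ + d₂ < dX)
      where
        Lift′ : Set → Set ℓ
        Lift′ P = Level.Lift ℓ P

    f : ℕ → ℕ → ℕ → ℤ
    f d₁ d₂ dX = (+ d₁ ℤ.+ + d₂) ℤ.- + dX

    -- ρ(V) = t  for the direct sum, V = rowsp(Y):
    -- t = dim V + min_{X ∈ 𝒳₀, X ≤ V} (ρ₁'(X) + ρ₂'(X) − dim X),
    -- the minimum being expressed as "attained" and "lower bound".
    Rank⊕ : ∀ {r} → Matrix K.Carrier r (n₁ + n₂) → ℕ → Set (c ⊔ ℓ ⊔ c′ ⊔ ℓ′)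
    Rank⊕ {r} Y t = Σ ℕ λ dV → HasRank K Y dV ×
      (Σ ℕ λ s → Σ (Matrix K.Carrier s r) λ A → Σ ℕ λ d₁ → Σ ℕ λ d₂ → Σ ℕ λ dX →
         Values (_⊙_ K A Y) d₁ d₂ dX × In𝒳₀ (_⊙_ K A Y) d₁ d₂ dX ×
         (+ t ≡ + dV ℤ.+ f d₁ d₂ dX)) ×
      (∀ s (A : Matrix K.Carrier s r) d₁ d₂ dX →
         Values (_⊙_ K A Y) d₁ d₂ dX → In𝒳₀ (_⊙_ K A Y) d₁ d₂ dX →
         + t ℤ.≤ + dV ℤ.+ f d₁ d₂ dX)

-- Let V be the row space of Y, π₁, π₂ the two coordinate projections and X₀ = V ∩ ker π₁.
-- Choose rows Yσ whose π₁-parts form a basis of π₁ V (a of them) and subtract their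
-- combinations from every row: the result Z spans X₀, so dim V = a + b with b = dim X₀.
-- The first n₁ rows of G act as ι ∘ π₁, and independence over 𝔽_q survives in 𝔽_{q^m};
-- the columns G Z vanish on that block, so rk(G Yᵀ) = a + d₂ with d₂ = ρ₂(π₂ X₀) ≤ b.
-- This is dim V + ρ₁'(X) + ρ₂'(X) − dim X for X = X₀ if d₂ < b, and for X = 0 otherwise.
-- Conversely, for any X ≤ V extend a basis of X by e rows of Y to a basis of V: then G Yᵀ is
-- spanned by the e corresponding columns, ι(π₁ X) ⊕ 0 and 0 ⊕ G₂(π₂ X), so
-- rk(G Yᵀ) ≤ e + ρ₁'(X) + ρ₂'(X) ≤ dim V − dim X + ρ₁'(X) + ρ₂'(X).

module Submission where

open import Level using (_⊔_; lift)
open import Function using (_∘_)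
open import Algebra.Bundles using (CommutativeRing)
open import Algebra.Morphism.Structures using (module RingMorphisms)
open import Data.Nat as ℕ using (ℕ; zero; suc; z≤n; s≤s)
import Data.Nat.Properties as ℕ
open import Algebra.Properties.CommutativeSemigroup ℕ.+-commutativeSemigroup using (xy∙z≈xz∙y)
open import Data.Integer as ℤ using (+_)
import Data.Integer.Properties as ℤ
open import Data.Integer.Solver using (module +-*-Solver)
open import Data.Fin as Fin using (Fin; zero; suc; _↑ˡ_; _↑ʳ_; splitAt)
import Data.Fin.Properties as Fin
open import Data.Sum using (_⊎_; inj₁; inj₂)
open import Data.Product using (∃; _,_; proj₁; proj₂)
open import Data.Empty using (⊥-elim)
open import Data.Vec.Functional using (Vector; _∷_; _++_; removeAt; transpose)
open import Data.Vec.Functional.Properties using (lookup-++ˡ; lookup-++ʳ)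
open import Relation.Nullary using (¬_; Dec; yes; no; ¬?)
open import Relation.Nullary.Decidable using (map′; decidable-stable)
open import Relation.Binary.Definitions using (Decidable)
open import Relation.Binary.PropositionalEquality as ≡ using (_≡_; _≗_)
open import Defs

↑-elim : ∀ {a} m {n} {P : Fin (m ℕ.+ n) → Set a} → (∀ i → P (i ↑ˡ n)) → (∀ j → P (m ↑ʳ j)) → ∀ x → P x
↑-elim zero    P↑ˡ P↑ʳ x       = P↑ʳ x
↑-elim (suc m) P↑ˡ P↑ʳ zero    = P↑ˡ zero
↑-elim (suc m) P↑ˡ P↑ʳ (suc x) = ↑-elim m (λ i → P↑ˡ (suc i)) P↑ʳ x

++-all : ∀ {a p} {A : Set a} {P : A → Set p} {m n} {U : Vector A m} {W : Vector A n} →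
         (∀ i → P (U i)) → (∀ j → P (W j)) → ∀ x → P ((U ++ W) x)
++-all {m = m} PU PW x with splitAt m x
... | inj₁ i = PU i
... | inj₂ j = PW j

map-∷-++ : ∀ {a b} {A : Set a} {B : Set b} {m p} (h : A → B) (x : A) (f : Vector A m) (g : Vector B p) →
           (λ i → h ((x ∷ f) i)) ++ g ≗ h x ∷ ((λ i → h (f i)) ++ g)
map-∷-++ h x f g zero = ≡.refl
map-∷-++ {m = m} h x f g (suc i) with splitAt m i
... | inj₁ _ = ≡.refl
... | inj₂ _ = ≡.refl

module LinearAlgebra {c ℓ} (R : CommutativeRing c ℓ) where
  open CommutativeRing R public hiding (zero)
  open import Algebra.Properties.Ring ring public
    using ( -‿distribˡ-*; -‿distribʳ-*; -0#≈0#; -‿+-comm; +-inverseˡ-unique; x[y-z]≈xy-xz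
          ; //-rightDividesˡ; //-rightDividesʳ)
  open import Algebra.Properties.Semiring.Sum semiring public
    using (sum; sum-cong-≋; ∑-comm; ∑-distrib-+; *-distribˡ-sum; *-distribʳ-sum; sum-remove)
  open import Data.Vec.Functional.Relation.Binary.Equality.Setoid setoid public
    using (_≋_; ≋-refl; ≋-reflexive; ≋-sym; ≋-trans; ++⁺)
  open import Relation.Binary.Reasoning.Setoid setoid public

  [x+y]-[x+z]≈y-z : ∀ x y z → (x + y) - (x + z) ≈ y - z
  [x+y]-[x+z]≈y-z x y z = begin
    (x + y) - (x + z)       ≈⟨ +-congˡ (-‿+-comm x z) ⟨
    (x + y) + (- x + - z)   ≈⟨ +-congʳ (+-comm x y) ⟩
    (y + x) + (- x + - z)   ≈⟨ +-assoc y x _ ⟩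
    y + (x + (- x + - z))   ≈⟨ +-congˡ (+-assoc x (- x) (- z)) ⟨
    y + ((x - x) + - z)     ≈⟨ +-congˡ (+-congʳ (-‿inverseʳ x)) ⟩
    y + (0# + - z)          ≈⟨ +-congˡ (+-identityˡ (- z)) ⟩
    y - z                   ∎

  infixl 6 _⊕_ _⊖_
  infixl 7 _⊛_

  0v : ∀ {n} → Vector Carrier n
  0v _ = 0#

  _⊕_ _⊖_ : ∀ {n} → Vector Carrier n → Vector Carrier n → Vector Carrier n
  (v ⊕ w) j = v j + w j
  (v ⊖ w) j = v j - w j

  _⊛_ : ∀ {n} → Carrier → Vector Carrier n → Vector Carrier n
  (a ⊛ v) j = a * v j

  lincomb : ∀ {p n} → Vector Carrier p → (Fin p → Vector Carrier n) → Vector Carrier n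
  lincomb α W j = sum (λ i → α i * W i j)

  sum-zero : ∀ {n} {f : Vector Carrier n} → f ≋ 0v → sum f ≈ 0#
  sum-zero {zero}  f≋0 = refl
  sum-zero {suc n} f≋0 = trans (+-cong (f≋0 zero) (sum-zero (λ i → f≋0 (suc i)))) (+-identityˡ 0#)

  sum-neg : ∀ {n} (f : Vector Carrier n) → sum (λ i → - f i) ≈ - sum f
  sum-neg {zero}  f = sym -0#≈0#
  sum-neg {suc n} f = trans (+-congˡ (sum-neg (λ i → f (suc i)))) (-‿+-comm (f zero) _)

  sum-split : ∀ m {n} (f : Vector Carrier (m ℕ.+ n)) →
              sum f ≈ sum (λ i → f (i ↑ˡ n)) + sum (λ j → f (m ↑ʳ j))
  sum-split zero    f = sym (+-identityˡ _)
  sum-split (suc m) f = trans (+-congˡ (sum-split m (λ i → f (suc i)))) (sym (+-assoc _ _ _))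

  lincomb-cong : ∀ {p n} {α β : Vector Carrier p} {U W : Fin p → Vector Carrier n} →
                 α ≋ β → (∀ i → U i ≋ W i) → lincomb α U ≋ lincomb β W
  lincomb-cong α≋β U≋W j = sum-cong-≋ (λ i → *-cong (α≋β i) (U≋W i j))

  lincomb-congˡ : ∀ {p n} {α β : Vector Carrier p} (W : Fin p → Vector Carrier n) →
                  α ≋ β → lincomb α W ≋ lincomb β W
  lincomb-congˡ W α≋β = lincomb-cong α≋β (λ _ → ≋-refl)

  lincomb-zeroˡ : ∀ {p n} {α : Vector Carrier p} (W : Fin p → Vector Carrier n) →
                  α ≋ 0v → lincomb α W ≋ 0v
  lincomb-zeroˡ W α≋0 j = sum-zero (λ i → trans (*-congʳ (α≋0 i)) (zeroˡ _))

  lincomb-zeroʳ : ∀ {p n} (α : Vector Carrier p) {W : Fin p → Vector Carrier n} →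
                  (∀ i → W i ≋ 0v) → lincomb α W ≋ 0v
  lincomb-zeroʳ α W≋0 j = sum-zero (λ i → trans (*-congˡ (W≋0 i j)) (zeroʳ _))

  lincomb-+ : ∀ {p n} (α β : Vector Carrier p) (W : Fin p → Vector Carrier n) →
              lincomb (λ i → α i + β i) W ≋ lincomb α W ⊕ lincomb β W
  lincomb-+ α β W j =
    trans (sum-cong-≋ (λ i → distribʳ (W i j) (α i) (β i))) (∑-distrib-+ (λ i → α i * W i j) (λ i → β i * W i j))

  lincomb-* : ∀ {p n} (a : Carrier) (α : Vector Carrier p) (W : Fin p → Vector Carrier n) →
              lincomb (λ i → a * α i) W ≋ a ⊛ lincomb α W
  lincomb-* a α W j = trans (sum-cong-≋ (λ i → *-assoc a (α i) (W i j))) (sym (*-distribˡ-sum a (λ i → α i * W i j)))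

  lincomb-neg : ∀ {p n} (α : Vector Carrier p) (W : Fin p → Vector Carrier n) j →
                lincomb (λ i → - α i) W j ≈ - lincomb α W j
  lincomb-neg α W j = trans (sum-cong-≋ (λ i → sym (-‿distribˡ-* (α i) (W i j)))) (sum-neg (λ i → α i * W i j))

  lincomb-- : ∀ {p n} (α β : Vector Carrier p) (W : Fin p → Vector Carrier n) →
              lincomb (λ i → α i - β i) W ≋ lincomb α W ⊖ lincomb β W
  lincomb-- α β W j = trans (lincomb-+ α (λ i → - β i) W j) (+-congˡ (lincomb-neg β W j))

  lincomb-sweep : ∀ {p n} (α a : Vector Carrier p) (W : Fin p → Vector Carrier n) (u : Vector Carrier n) →
                  lincomb α (λ i → W i ⊖ a i ⊛ u) ≋ lincomb α W ⊖ sum (λ i → α i * a i) ⊛ u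
  lincomb-sweep α a W u j = begin
    sum (λ i → α i * (W i j - a i * u j))             ≈⟨ sum-cong-≋ (λ i → x[y-z]≈xy-xz (α i) (W i j) (a i * u j)) ⟩
    sum (λ i → α i * W i j - α i * (a i * u j))
      ≈⟨ ∑-distrib-+ (λ i → α i * W i j) (λ i → - (α i * (a i * u j))) ⟩
    lincomb α W j + sum (λ i → - (α i * (a i * u j))) ≈⟨ +-congˡ (sum-neg (λ i → α i * (a i * u j))) ⟩
    lincomb α W j - sum (λ i → α i * (a i * u j))
      ≈⟨ +-congˡ (-‿cong (sum-cong-≋ (λ i → *-assoc (α i) (a i) (u j)))) ⟨
    lincomb α W j - sum (λ i → α i * a i * u j)       ≈⟨ +-congˡ (-‿cong (*-distribʳ-sum (u j) (λ i → α i * a i))) ⟨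
    lincomb α W j - sum (λ i → α i * a i) * u j       ∎

  lincomb-unsweep : ∀ {s n} (α : Vector Carrier (suc s)) (a : Vector Carrier s) (v : Fin (suc s) → Vector Carrier n) →
                    lincomb α v ≋ (α zero + sum (λ k → α (suc k) * a k)) ⊛ v zero
                                  ⊕ lincomb (λ k → α (suc k)) (λ k → v (suc k) ⊖ a k ⊛ v zero)
  lincomb-unsweep α a v j = begin
    α zero * x + T                      ≈⟨ +-congˡ (//-rightDividesˡ (S * x) T) ⟨
    α zero * x + ((T - S * x) + S * x)  ≈⟨ +-congˡ (+-comm _ _) ⟩
    α zero * x + (S * x + (T - S * x))  ≈⟨ +-assoc _ _ _ ⟨
    (α zero * x + S * x) + (T - S * x)  ≈⟨ +-cong (distribʳ x (α zero) S) (lincomb-sweep tailα a tailv (v zero) j) ⟨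
    (α zero + S) * x + lincomb tailα (λ k → tailv k ⊖ a k ⊛ v zero) j ∎
    where
    tailα = λ k → α (suc k)
    tailv = λ k → v (suc k)
    x = v zero j
    S = sum (λ k → tailα k * a k)
    T = lincomb tailα tailv j

  lincomb-assoc : ∀ {p p′ n} (α : Vector Carrier p) (D : Fin p → Vector Carrier p′)
                  (W : Fin p′ → Vector Carrier n) →
                  lincomb α (λ i → lincomb (D i) W) ≋ lincomb (lincomb α D) W
  lincomb-assoc α D W j = begin
    sum (λ i → α i * sum (λ k → D i k * W k j))
      ≈⟨ sum-cong-≋ (λ i → *-distribˡ-sum (α i) (λ k → D i k * W k j)) ⟩
    sum (λ i → sum (λ k → α i * (D i k * W k j)))
      ≈⟨ sum-cong-≋ (λ i → sum-cong-≋ (λ k → sym (*-assoc (α i) (D i k) (W k j)))) ⟩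
    sum (λ i → sum (λ k → α i * D i k * W k j))
      ≈⟨ ∑-comm (λ i k → α i * D i k * W k j) ⟩
    sum (λ k → sum (λ i → α i * D i k * W k j))
      ≈⟨ sum-cong-≋ (λ k → sym (*-distribʳ-sum (W k j) (λ i → α i * D i k))) ⟩
    sum (λ k → sum (λ i → α i * D i k) * W k j)   ∎

  δ : ∀ {p} → Fin p → Vector Carrier p
  δ zero    zero    = 1#
  δ zero    (suc _) = 0#
  δ (suc _) zero    = 0#
  δ (suc i) (suc k) = δ i k

  δ-diagonal : ∀ {p} (i : Fin p) → δ i i ≡ 1#
  δ-diagonal zero    = ≡.refl
  δ-diagonal (suc i) = δ-diagonal i

  sum-δ : ∀ {p} (i : Fin p) (x : Vector Carrier p) → sum (λ k → δ i k * x k) ≈ x i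
  sum-δ zero    x = trans (+-cong (*-identityˡ _) (sum-zero (λ k → zeroˡ (x (suc k))))) (+-identityʳ _)
  sum-δ (suc i) x = trans (+-cong (zeroˡ _) (sum-δ i (λ k → x (suc k)))) (+-identityˡ _)

  lincomb-δ : ∀ {p n} (i : Fin p) (W : Fin p → Vector Carrier n) → lincomb (δ i) W ≋ W i
  lincomb-δ i W j = sum-δ i (λ k → W k j)

  identity≡δ : ∀ {n} (i j : Fin n) → identity R n i j ≡ δ i j
  identity≡δ zero    zero    = ≡.refl
  identity≡δ zero    (suc j) = ≡.refl
  identity≡δ (suc i) zero    = ≡.refl
  identity≡δ (suc i) (suc j) with i Fin.≟ j | identity≡δ i j
  ... | yes _ | eq = eq
  ... | no _  | eq = eq

  module _ {a₁ b₁ a₂ b₂} (A : Matrix Carrier a₁ b₁) (B : Matrix Carrier a₂ b₂) where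

    blockDiag-↑ˡ-↑ˡ : ∀ i j → blockDiag R A B (i ↑ˡ a₂) (j ↑ˡ b₂) ≡ A i j
    blockDiag-↑ˡ-↑ˡ i j rewrite Fin.splitAt-↑ˡ a₁ i a₂ | Fin.splitAt-↑ˡ b₁ j b₂ = ≡.refl

    blockDiag-↑ˡ-↑ʳ : ∀ i j → blockDiag R A B (i ↑ˡ a₂) (b₁ ↑ʳ j) ≡ 0#
    blockDiag-↑ˡ-↑ʳ i j rewrite Fin.splitAt-↑ˡ a₁ i a₂ | Fin.splitAt-↑ʳ b₁ b₂ j = ≡.refl

    blockDiag-↑ʳ-↑ˡ : ∀ i j → blockDiag R A B (a₁ ↑ʳ i) (j ↑ˡ b₂) ≡ 0#
    blockDiag-↑ʳ-↑ˡ i j rewrite Fin.splitAt-↑ʳ a₁ a₂ i | Fin.splitAt-↑ˡ b₁ j b₂ = ≡.refl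

    blockDiag-↑ʳ-↑ʳ : ∀ i j → blockDiag R A B (a₁ ↑ʳ i) (b₁ ↑ʳ j) ≡ B i j
    blockDiag-↑ʳ-↑ʳ i j rewrite Fin.splitAt-↑ʳ a₁ a₂ i | Fin.splitAt-↑ʳ b₁ b₂ j = ≡.refl

  lincomb-++ : ∀ {m p n} (α : Vector Carrier (m ℕ.+ p)) (U : Fin m → Vector Carrier n) (W : Fin p → Vector Carrier n) →
               lincomb α (U ++ W) ≋ lincomb (λ i → α (i ↑ˡ p)) U ⊕ lincomb (λ j → α (m ↑ʳ j)) W
  lincomb-++ {m} α U W j = trans (sum-split m (λ i → α i * (U ++ W) i j))
    (+-cong (sum-cong-≋ (λ i → *-congˡ (reflexive (≡.cong (λ v → v j) (lookup-++ˡ U W i)))))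
            (sum-cong-≋ (λ i → *-congˡ (reflexive (≡.cong (λ v → v j) (lookup-++ʳ U W i))))))

  lincomb-removeAt : ∀ {p n} (i : Fin (suc p)) (α : Vector Carrier (suc p)) (W : Fin (suc p) → Vector Carrier n) →
                     lincomb α W ≋ α i ⊛ W i ⊕ lincomb (removeAt α i) (removeAt W i)
  lincomb-removeAt i α W j = sum-remove {i = i} (λ k → α k * W k j)

  infix 4 _∈⟨_⟩ _⊆⟨_⟩

  _∈⟨_⟩ : ∀ {p n} → Vector Carrier n → (Fin p → Vector Carrier n) → Set (c ⊔ ℓ)
  v ∈⟨ W ⟩ = ∃ λ α → v ≋ lincomb α W

  _⊆⟨_⟩ : ∀ {p p′ n} → (Fin p → Vector Carrier n) → (Fin p′ → Vector Carrier n) → Set (c ⊔ ℓ)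
  U ⊆⟨ W ⟩ = ∀ i → U i ∈⟨ W ⟩

  ∈⟨⟩-respˡ-≋ : ∀ {p n} {W : Fin p → Vector Carrier n} {v v′} → v ≋ v′ → v ∈⟨ W ⟩ → v′ ∈⟨ W ⟩
  ∈⟨⟩-respˡ-≋ v≋v′ (α , v≋αW) = α , λ j → trans (sym (v≋v′ j)) (v≋αW j)

  ∈⟨⟩-respʳ-≋ : ∀ {p n} {U W : Fin p → Vector Carrier n} {v} →
                (∀ i → U i ≋ W i) → v ∈⟨ U ⟩ → v ∈⟨ W ⟩
  ∈⟨⟩-respʳ-≋ U≋W (α , v≋αU) = α , λ j → trans (v≋αU j) (lincomb-cong ≋-refl U≋W j)

  ⊆⟨⟩-refl : ∀ {p n} (W : Fin p → Vector Carrier n) → W ⊆⟨ W ⟩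
  ⊆⟨⟩-refl W i = δ i , λ j → sym (lincomb-δ i W j)

  ∈⟨⟩-trans : ∀ {p p′ n} {U : Fin p → Vector Carrier n} {W : Fin p′ → Vector Carrier n} {v} →
              v ∈⟨ U ⟩ → U ⊆⟨ W ⟩ → v ∈⟨ W ⟩
  ∈⟨⟩-trans {U = U} {W} (α , v≋αU) U⊆W =
    lincomb α (λ i → proj₁ (U⊆W i)) ,
    λ j → trans (v≋αU j) (trans (lincomb-cong ≋-refl (λ i → proj₂ (U⊆W i)) j)
                                (lincomb-assoc α (λ i → proj₁ (U⊆W i)) W j))

  ∈⟨⟩-⊕ : ∀ {p n} {W : Fin p → Vector Carrier n} {v w} → v ∈⟨ W ⟩ → w ∈⟨ W ⟩ → v ⊕ w ∈⟨ W ⟩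
  ∈⟨⟩-⊕ {W = W} (α , v≋αW) (β , w≋βW) =
    (λ i → α i + β i) , λ j → trans (+-cong (v≋αW j) (w≋βW j)) (sym (lincomb-+ α β W j))

  ∈⟨⟩-∷ : ∀ {p n} (u : Vector Carrier n) {W : Fin p → Vector Carrier n} {v} → v ∈⟨ W ⟩ → v ∈⟨ u ∷ W ⟩
  ∈⟨⟩-∷ u (α , v≋αW) =
    (0# ∷ α) , λ j → trans (v≋αW j) (trans (sym (+-identityˡ _)) (+-congʳ (sym (zeroˡ (u j)))))

  ∈⟨⟩-++ˡ : ∀ {m p n} {U : Fin m → Vector Carrier n} (W : Fin p → Vector Carrier n) {v} →
            v ∈⟨ U ⟩ → v ∈⟨ U ++ W ⟩
  ∈⟨⟩-++ˡ {m} {p} {U = U} W (α , v≋αU) = (α ++ 0v) , λ j → trans (v≋αU j) (sym (trans (lincomb-++ (α ++ 0v) U W j)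
    (trans (+-cong (lincomb-congˡ U (λ i → reflexive (lookup-++ˡ α (0v {p}) i)) j)
                   (lincomb-zeroˡ W (λ i → reflexive (lookup-++ʳ {m = m} α 0v i)) j))
           (+-identityʳ _))))

  ∈⟨⟩-++ʳ : ∀ {m p n} (U : Fin m → Vector Carrier n) {W : Fin p → Vector Carrier n} {v} →
            v ∈⟨ W ⟩ → v ∈⟨ U ++ W ⟩
  ∈⟨⟩-++ʳ {m} U {W} (β , v≋βW) = (0v ++ β) , λ j → trans (v≋βW j) (sym (trans (lincomb-++ (0v ++ β) U W j)
    (trans (+-cong (lincomb-zeroˡ U (λ i → reflexive (lookup-++ˡ (0v {m}) β i)) j)
                   (lincomb-congˡ W (λ i → reflexive (lookup-++ʳ (0v {m}) β i)) j))
           (+-identityˡ _))))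

  ⊆⟨⟩-++ : ∀ {m p p′ n} {U : Fin m → Vector Carrier n} {W : Fin p → Vector Carrier n}
             {M : Fin p′ → Vector Carrier n} → U ⊆⟨ M ⟩ → W ⊆⟨ M ⟩ → U ++ W ⊆⟨ M ⟩
  ⊆⟨⟩-++ {M = M} = ++-all {P = _∈⟨ M ⟩}

  lincomb-++-columns : ∀ {p m n} (α : Vector Carrier p) (U : Fin p → Vector Carrier m) (W : Fin p → Vector Carrier n) →
                       lincomb α (λ i → U i ++ W i) ≋ lincomb α U ++ lincomb α W
  lincomb-++-columns {m = m} α U W = ↑-elim m
    (λ j → trans (sum-cong-≋ (λ i → *-congˡ (reflexive (lookup-++ˡ (U i) (W i) j))))
                 (reflexive (≡.sym (lookup-++ˡ (lincomb α U) (lincomb α W) j))))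
    (λ j → trans (sum-cong-≋ (λ i → *-congˡ (reflexive (lookup-++ʳ (U i) (W i) j))))
                 (reflexive (≡.sym (lookup-++ʳ (lincomb α U) (lincomb α W) j))))

  ∈⟨⟩-padʳ : ∀ {p m n} {U : Fin p → Vector Carrier m} {u} → u ∈⟨ U ⟩ → u ++ 0v {n} ∈⟨ (λ i → U i ++ 0v) ⟩
  ∈⟨⟩-padʳ {U = U} (α , u≋αU) =
    α , ≋-trans (++⁺ _≈_ u≋αU (≋-sym (lincomb-zeroʳ α (λ _ → ≋-refl))))
                (≋-sym (lincomb-++-columns α U (λ _ → 0v)))

  ∈⟨⟩-padˡ : ∀ {p m n} {W : Fin p → Vector Carrier n} {w} → w ∈⟨ W ⟩ → 0v {m} ++ w ∈⟨ (λ i → 0v ++ W i) ⟩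
  ∈⟨⟩-padˡ {W = W} (α , w≋αW) =
    α , ≋-trans (++⁺ _≈_ (≋-sym (lincomb-zeroʳ α (λ _ → ≋-refl))) w≋αW)
                (≋-sym (lincomb-++-columns α (λ _ → 0v) W))

  ++-≋-⊕ : ∀ {m n} (u : Vector Carrier m) (w : Vector Carrier n) → u ++ w ≋ (u ++ 0v) ⊕ (0v ++ w)
  ++-≋-⊕ {m} u w = ↑-elim m
    (λ i → trans (reflexive (lookup-++ˡ u w i)) (sym (trans (+-cong (reflexive (lookup-++ˡ u 0v i))
                                                                    (reflexive (lookup-++ˡ 0v w i))) (+-identityʳ _))))
    (λ j → trans (reflexive (lookup-++ʳ u w j)) (sym (trans (+-cong (reflexive (lookup-++ʳ u 0v j))
                                                                    (reflexive (lookup-++ʳ (0v {m}) w j))) (+-identityˡ _))))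

  ∈⟨⟩-++-blocks : ∀ {p p′ m n} {U : Fin p → Vector Carrier m} {W : Fin p′ → Vector Carrier n} {u w} →
                  u ∈⟨ U ⟩ → w ∈⟨ W ⟩ → u ++ w ∈⟨ (λ i → U i ++ 0v) ++ (λ j → 0v ++ W j) ⟩
  ∈⟨⟩-++-blocks {W = W} {u} {w} u∈U w∈W = ∈⟨⟩-respˡ-≋ (≋-sym (++-≋-⊕ u w))
    (∈⟨⟩-⊕ (∈⟨⟩-++ˡ (λ j → 0v ++ W j) (∈⟨⟩-padʳ u∈U)) (∈⟨⟩-++ʳ _ (∈⟨⟩-padˡ w∈W)))

  ∈⟨⟩-restrict : ∀ {p m n} {W : Fin p → Vector Carrier n} {v} (f : Fin m → Fin n) →
                 v ∈⟨ W ⟩ → (λ j → v (f j)) ∈⟨ (λ i j → W i (f j)) ⟩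
  ∈⟨⟩-restrict f (α , v≋αW) = α , λ j → v≋αW (f j)

  LinIndep-restrict : ∀ {p m n} {W : Fin p → Vector Carrier n} (f : Fin m → Fin n) →
                      LinIndep R (λ i j → W i (f j)) → LinIndep R W
  LinIndep-restrict f indep α αW≋0 = indep α (λ j → αW≋0 (f j))

  LinIndep-resp-≋ : ∀ {p n} {U W : Fin p → Vector Carrier n} → (∀ i → U i ≋ W i) → LinIndep R U → LinIndep R W
  LinIndep-resp-≋ U≋W indepU α αW≋0 = indepU α λ j → trans (lincomb-cong ≋-refl U≋W j) (αW≋0 j)

  LinIndep-++ : ∀ {m p n k} {U : Fin m → Vector Carrier n} {W : Fin p → Vector Carrier n} (f : Fin k → Fin n) →
                LinIndep R (λ i j → U i (f j)) → (∀ i j → W i (f j) ≈ 0#) → LinIndep R W → LinIndep R (U ++ W)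
  LinIndep-++ {m} {p} {U = U} {W} f indepU Wf≈0 indepW α α[U++W]≋0 = ↑-elim m αU≈0 αW≈0
    where
    αU = λ i → α (i ↑ˡ p)
    αW = λ j → α (m ↑ʳ j)
    αU+αW≈0 : ∀ j → lincomb αU U j + lincomb αW W j ≈ 0#
    αU+αW≈0 j = trans (sym (lincomb-++ α U W j)) (α[U++W]≋0 j)
    αU≈0 : αU ≋ 0v
    αU≈0 = indepU αU λ j → trans (sym (+-identityʳ _))
      (trans (+-congˡ (sym (lincomb-zeroʳ αW {W = λ i j → W i (f j)} Wf≈0 j))) (αU+αW≈0 (f j)))
    αW≈0 : αW ≋ 0v
    αW≈0 = indepW αW λ j → trans (sym (+-identityˡ _)) (trans (+-congʳ (sym (lincomb-zeroˡ U αU≈0 j))) (αU+αW≈0 j))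

  LinIndep-sweep : ∀ {s n} {v : Fin (suc s) → Vector Carrier n} (a : Vector Carrier s) →
                   LinIndep R v → LinIndep R (λ i → v (suc i) ⊖ a i ⊛ v zero)
  LinIndep-sweep {v = v} a indep α αv′≋0 i = indep (- S ∷ α) αv≋0 (suc i)
    where
    S = sum (λ k → α k * a k)
    αv≋0 : ∀ j → - S * v zero j + lincomb α (λ k → v (suc k)) j ≈ 0#
    αv≋0 j = begin
      - S * v zero j + lincomb α (λ k → v (suc k)) j  ≈⟨ +-comm _ _ ⟩
      lincomb α (λ k → v (suc k)) j + - S * v zero j  ≈⟨ +-congˡ (-‿distribˡ-* S _) ⟨
      lincomb α (λ k → v (suc k)) j - S * v zero j    ≈⟨ lincomb-sweep α a (λ k → v (suc k)) (v zero) j ⟨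
      lincomb α (λ k → v (suc k) ⊖ a k ⊛ v zero) j    ≈⟨ αv′≋0 j ⟩
      0#                                             ∎

  ∈⟨⟩-removeAt : ∀ {p n} {w : Fin (suc p) → Vector Carrier n} {C₀ C : Vector Carrier (suc p)}
                 {x u : Vector Carrier n} k {b} → C₀ k * b ≈ 1# →
                 x ≋ lincomb C₀ w → u ≋ lincomb C w → u ⊖ (C k * b) ⊛ x ∈⟨ removeAt w k ⟩
  ∈⟨⟩-removeAt {w = w} {C₀} {C} {x} {u} k {b} C₀ₖb≈1 x≋C₀w u≋Cw =
    (λ i → C′ i - a * C₀′ i) , λ j → begin
      u j - a * x j
        ≈⟨ +-cong (trans (u≋Cw j) (lincomb-removeAt k C w j))
                  (-‿cong (*-congˡ (trans (x≋C₀w j) (lincomb-removeAt k C₀ w j)))) ⟩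
      (C k * w k j + lincomb C′ w′ j) - a * (C₀ k * w k j + lincomb C₀′ w′ j)
        ≈⟨ +-congˡ (-‿cong (trans (distribˡ a _ _) (+-congʳ (trans (sym (*-assoc a _ _)) (*-congʳ aC₀ₖ≈Cₖ))))) ⟩
      (C k * w k j + lincomb C′ w′ j) - (C k * w k j + a * lincomb C₀′ w′ j)
        ≈⟨ [x+y]-[x+z]≈y-z _ _ _ ⟩
      lincomb C′ w′ j - a * lincomb C₀′ w′ j
        ≈⟨ +-congˡ (-‿cong (lincomb-* a C₀′ w′ j)) ⟨
      lincomb C′ w′ j - lincomb (λ i → a * C₀′ i) w′ j
        ≈⟨ lincomb-- C′ (λ i → a * C₀′ i) w′ j ⟨
      lincomb (λ i → C′ i - a * C₀′ i) w′ j ∎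
    where
    a = C k * b
    C′ = removeAt C k
    C₀′ = removeAt C₀ k
    w′ = removeAt w k
    aC₀ₖ≈Cₖ : a * C₀ k ≈ C k
    aC₀ₖ≈Cₖ = trans (*-assoc (C k) b (C₀ k)) (trans (*-congˡ (trans (*-comm b (C₀ k)) C₀ₖb≈1)) (*-identityʳ (C k)))

module Field {c ℓ} (R : CommutativeRing c ℓ) (isField : IsField R) where
  open LinearAlgebra R public

  0≉1 : ¬ 0# ≈ 1#
  0≉1 = proj₁ isField

  inverse : ∀ {x} → ¬ x ≈ 0# → ∃ λ y → x * y ≈ 1#
  inverse = proj₂ isField _

  x*y≈0⇒x≈0 : ∀ {x y} → x * y ≈ 0# → ¬ y ≈ 0# → x ≈ 0#
  x*y≈0⇒x≈0 {x} {y} xy≈0 y≉0 with inverse y≉0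
  ... | y⁻¹ , yy⁻¹≈1 = begin
    x              ≈⟨ *-identityʳ x ⟨
    x * 1#         ≈⟨ *-congˡ yy⁻¹≈1 ⟨
    x * (y * y⁻¹)  ≈⟨ *-assoc x y y⁻¹ ⟨
    x * y * y⁻¹    ≈⟨ *-congʳ xy≈0 ⟩
    0# * y⁻¹       ≈⟨ zeroˡ y⁻¹ ⟩
    0#             ∎

  LinIndep⇒≉0v : ∀ {p n} (W : Fin p → Vector Carrier n) → LinIndep R W → ∀ i → ¬ W i ≋ 0v
  LinIndep⇒≉0v W indep i Wᵢ≋0 = 0≉1 (sym (trans (reflexive (≡.sym (δ-diagonal i)))
                                                 (indep (δ i) (λ j → trans (lincomb-δ i W j) (Wᵢ≋0 j)) i)))

  LinIndep-unsweep : ∀ {s n} {v : Fin (suc s) → Vector Carrier n} (a : Vector Carrier s) j₀ →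
                     ¬ v zero j₀ ≈ 0# → (∀ k → v (suc k) j₀ - a k * v zero j₀ ≈ 0#) →
                     LinIndep R (λ k → v (suc k) ⊖ a k ⊛ v zero) → LinIndep R v
  LinIndep-unsweep {v = v} a j₀ v₀≉0 v′≈0 indep′ α αv≋0 = α≈0
    where
    v′ = λ k → v (suc k) ⊖ a k ⊛ v zero
    tailα = λ k → α (suc k)
    β = α zero + sum (λ k → tailα k * a k)
    βv₀+αv′≈0 : ∀ j → β * v zero j + lincomb tailα v′ j ≈ 0#
    βv₀+αv′≈0 j = trans (sym (lincomb-unsweep α a v j)) (αv≋0 j)
    β≈0 : β ≈ 0#
    β≈0 = x*y≈0⇒x≈0 (trans (sym (+-identityʳ _))
            (trans (+-congˡ (sym (lincomb-zeroʳ tailα {W = λ k _ → v′ k j₀} (λ k _ → v′≈0 k) j₀)))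
                   (βv₀+αv′≈0 j₀))) v₀≉0
    tailα≈0 : tailα ≋ 0v
    tailα≈0 = indep′ tailα λ j → trans (sym (+-identityˡ _))
                (trans (+-congʳ (sym (trans (*-congʳ β≈0) (zeroˡ _)))) (βv₀+αv′≈0 j))
    α≈0 : α ≋ 0v
    α≈0 zero = begin
      α zero                                ≈⟨ +-identityʳ _ ⟨
      α zero + 0#                           ≈⟨ +-congˡ (sum-zero (λ k → trans (*-congʳ (tailα≈0 k)) (zeroˡ _))) ⟨
      β                                     ≈⟨ β≈0 ⟩
      0#                                    ∎
    α≈0 (suc k) = tailα≈0 k

module DiscreteField {c ℓ} (R : CommutativeRing c ℓ) (isField : IsField R)
                     (_≟_ : Decidable (CommutativeRing._≈_ R)) where
  open Field R isField public

  ≋0v-or-nonzeroEntry : ∀ {n} (v : Vector Carrier n) → v ≋ 0v ⊎ ∃ λ k → ¬ v k ≈ 0#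
  ≋0v-or-nonzeroEntry v with Fin.any? (λ k → ¬? (v k ≟ 0#))
  ... | yes nonzero = inj₂ nonzero
  ... | no ¬nonzero = inj₁ λ k → decidable-stable (v k ≟ 0#) (λ vₖ≉0 → ¬nonzero (k , vₖ≉0))

  LinIndep-∷ : ∀ {p n} {v : Vector Carrier n} {W : Fin p → Vector Carrier n} →
               LinIndep R W → ¬ v ∈⟨ W ⟩ → LinIndep R (v ∷ W)
  LinIndep-∷ {v = v} {W} indep v∉W α αvW≋0 with α zero ≟ 0#
  ... | no α₀≉0 = ⊥-elim (v∉W (v∈W (inverse α₀≉0)))
    where
    v∈W : ∃ (λ b → α zero * b ≈ 1#) → v ∈⟨ W ⟩
    v∈W (b , α₀b≈1) = (λ k → - (b * α (suc k))) , λ j → begin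
      v j                                         ≈⟨ *-identityˡ (v j) ⟨
      1# * v j                                    ≈⟨ *-congʳ (trans (*-comm b (α zero)) α₀b≈1) ⟨
      b * α zero * v j                            ≈⟨ *-assoc b _ _ ⟩
      b * (α zero * v j)                          ≈⟨ *-congˡ (+-inverseˡ-unique _ _ (αvW≋0 j)) ⟩
      b * - lincomb (λ k → α (suc k)) W j         ≈⟨ -‿distribʳ-* b _ ⟨
      - (b * lincomb (λ k → α (suc k)) W j)       ≈⟨ -‿cong (lincomb-* b (λ k → α (suc k)) W j) ⟨
      - lincomb (λ k → b * α (suc k)) W j         ≈⟨ lincomb-neg (λ k → b * α (suc k)) W j ⟨
      lincomb (λ k → - (b * α (suc k))) W j       ∎
  ... | yes α₀≈0 = λ where
      zero    → α₀≈0
      (suc i) → indep (λ k → α (suc k)) (λ j → begin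
        lincomb (λ k → α (suc k)) W j             ≈⟨ +-identityˡ _ ⟨
        0# + lincomb (λ k → α (suc k)) W j        ≈⟨ +-congʳ (trans (*-congʳ α₀≈0) (zeroˡ (v j))) ⟨
        α zero * v j + lincomb (λ k → α (suc k)) W j ≈⟨ αvW≋0 j ⟩
        0#                                        ∎) i

  steinitz : ∀ {s p n} {v : Fin s → Vector Carrier n} {w : Fin p → Vector Carrier n} →
             LinIndep R v → v ⊆⟨ w ⟩ → s ℕ.≤ p
  steinitz {zero}  _ _ = z≤n
  steinitz {suc s} {zero} {v = v} indep v⊆w = ⊥-elim (LinIndep⇒≉0v v indep zero (proj₂ (v⊆w zero)))
  steinitz {suc s} {suc p} {v = v} {w} indep v⊆w with v⊆w zero
  ... | C₀ , v₀≋C₀w with ≋0v-or-nonzeroEntry C₀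
  ...   | inj₁ C₀≋0 = ⊥-elim (LinIndep⇒≉0v v indep zero (λ j → trans (v₀≋C₀w j) (lincomb-zeroˡ w C₀≋0 j)))
  ...   | inj₂ (k , C₀ₖ≉0) with inverse C₀ₖ≉0
  ...     | b , C₀ₖb≈1 = s≤s (steinitz (LinIndep-sweep {v = v} a indep) v′⊆w′)
    where
    a : Vector Carrier s
    a i = proj₁ (v⊆w (suc i)) k * b
    v′⊆w′ : (λ i → v (suc i) ⊖ a i ⊛ v zero) ⊆⟨ removeAt w k ⟩
    v′⊆w′ i = ∈⟨⟩-removeAt {w = w} {C₀} {proj₁ (v⊆w (suc i))} k C₀ₖb≈1 v₀≋C₀w (proj₂ (v⊆w (suc i)))

module _ {c ℓ} (R : CommutativeRing c ℓ) where
  open CommutativeRing R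

  HasCardinality⇒≈-decidable : ∀ {q} → HasCardinality R q → Decidable _≈_
  HasCardinality⇒≈-decidable (enum , injective , surjective) x y with surjective x | surjective y
  ... | i , eᵢ≈x | j , eⱼ≈y with i Fin.≟ j
  ... | yes ≡.refl = yes (trans (sym eᵢ≈x) eⱼ≈y)
  ... | no i≢j = no (λ x≈y → i≢j (injective i j (trans eᵢ≈x (trans x≈y (sym eⱼ≈y)))))

module FiniteField {c ℓ} (R : CommutativeRing c ℓ) (isField : IsField R) {q} (card : HasCardinality R q) where
  _≟_ : Decidable (CommutativeRing._≈_ R)
  _≟_ = HasCardinality⇒≈-decidable R card

  open DiscreteField R isField _≟_ public

  private
    enum = proj₁ card
    enum-surjective = proj₂ (proj₂ card)

  -- Searches all values of the first coefficient: the one use of finiteness of the field.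
  _∈⟨_⟩? : ∀ {p n} (v : Vector Carrier n) (W : Fin p → Vector Carrier n) → Dec (v ∈⟨ W ⟩)
  _∈⟨_⟩? {zero} v W = map′ (λ v≋0 → (λ ()) , v≋0) proj₂ (Fin.all? (λ j → v j ≟ 0#))
  _∈⟨_⟩? {suc p} v W = map′ from to (Fin.any? (λ x → (v ⊖ enum x ⊛ W zero) ∈⟨ (λ i → W (suc i)) ⟩?))
    where
    from : ∃ (λ x → v ⊖ enum x ⊛ W zero ∈⟨ (λ i → W (suc i)) ⟩) → v ∈⟨ W ⟩
    from (x , α , rest≋) = (enum x ∷ α) , λ j →
      trans (sym (//-rightDividesˡ _ (v j))) (trans (+-comm _ _) (+-congˡ (rest≋ j)))
    to : v ∈⟨ W ⟩ → ∃ λ x → v ⊖ enum x ⊛ W zero ∈⟨ (λ i → W (suc i)) ⟩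
    to (α , v≋αW) with enum-surjective (α zero)
    ... | x , eₓ≈α₀ = x , (λ i → α (suc i)) , λ j → begin
      v j - enum x * W zero j                                         ≈⟨ +-cong (v≋αW j) (-‿cong (*-congʳ eₓ≈α₀)) ⟩
      (α zero * W zero j + lincomb (λ i → α (suc i)) (λ i → W (suc i)) j) - α zero * W zero j
                                                                     ≈⟨ +-congʳ (+-comm _ _) ⟩
      (lincomb (λ i → α (suc i)) (λ i → W (suc i)) j + α zero * W zero j) - α zero * W zero j
                                                                     ≈⟨ //-rightDividesʳ _ _ ⟩
      lincomb (λ i → α (suc i)) (λ i → W (suc i)) j                   ∎

  record RowBasis {a n} (M : Fin a → Vector Carrier n) : Set (c ⊔ ℓ) where
    field
      dim         : ℕ
      row         : Fin dim → Fin a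
      independent : LinIndep R (λ i → M (row i))
      spanning    : M ⊆⟨ (λ i → M (row i)) ⟩

  rowBasis : ∀ {a n} (M : Fin a → Vector Carrier n) → RowBasis M
  rowBasis {zero}  M = record { dim = 0 ; row = λ () ; independent = λ _ _ () ; spanning = λ () }
  rowBasis {suc a} M with rowBasis (λ l → M (suc l))
  ... | record { dim = d ; row = σ ; independent = indep ; spanning = tail⊆ }
      with M zero ∈⟨ (λ i → M (suc (σ i))) ⟩?
  ...   | yes M₀∈ = record { dim = d ; row = λ i → suc (σ i) ; independent = indep
                           ; spanning = λ { zero → M₀∈ ; (suc l) → tail⊆ l } }
  ...   | no M₀∉ = record
    { dim = suc d
    ; row = zero ∷ (λ i → suc (σ i))
    ; independent = LinIndep-resp-≋ {U = M zero ∷ Mσ} {W = λ i → M ((zero ∷ sσ) i)}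
                                    (λ { zero → ≋-refl ; (suc i) → ≋-refl }) (LinIndep-∷ {W = Mσ} indep M₀∉)
    ; spanning = λ { zero → ⊆⟨⟩-refl (λ i → M ((zero ∷ sσ) i)) zero
                   ; (suc l) → ∈⟨⟩-∷ (M zero) (tail⊆ l) }
    }
    where
    sσ = λ i → suc (σ i)
    Mσ = λ i → M (sσ i)

  record BasisExtension {a p n} (M : Fin a → Vector Carrier n) (B : Fin p → Vector Carrier n) : Set (c ⊔ ℓ) where
    field
      size        : ℕ
      row         : Fin size → Fin a
      independent : LinIndep R ((λ i → M (row i)) ++ B)
      spanning    : M ⊆⟨ (λ i → M (row i)) ++ B ⟩

  extendBasis : ∀ {a p n} (M : Fin a → Vector Carrier n) {B : Fin p → Vector Carrier n} →
                LinIndep R B → BasisExtension M B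
  extendBasis {zero}  M indep = record { size = 0 ; row = λ () ; independent = indep ; spanning = λ () }
  extendBasis {suc a} M {B} indep with extendBasis (λ l → M (suc l)) indep
  ... | record { size = e ; row = τ ; independent = indep′ ; spanning = tail⊆ }
      with M zero ∈⟨ (λ i → M (suc (τ i))) ++ B ⟩?
  ...   | yes M₀∈ = record { size = e ; row = λ i → suc (τ i) ; independent = indep′
                           ; spanning = λ { zero → M₀∈ ; (suc l) → tail⊆ l } }
  ...   | no M₀∉ = record
    { size = suc e
    ; row = zero ∷ (λ i → suc (τ i))
    ; independent = LinIndep-resp-≋ {U = M zero ∷ (Mτ ++ B)} {W = (λ i → M ((zero ∷ sτ) i)) ++ B}
                                    (λ x → ≋-reflexive (≡.sym (map-∷-++ M zero sτ B x)))
                                    (LinIndep-∷ {W = Mτ ++ B} indep′ M₀∉)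
    ; spanning = λ l → ∈⟨⟩-respʳ-≋ (λ x → ≋-reflexive (≡.sym (map-∷-++ M zero sτ B x))) (M⊆ l)
    }
    where
    sτ = λ i → suc (τ i)
    Mτ = λ i → M (sτ i)
    M⊆ : M ⊆⟨ M zero ∷ (Mτ ++ B) ⟩
    M⊆ zero    = ⊆⟨⟩-refl (M zero ∷ (Mτ ++ B)) zero
    M⊆ (suc l) = ∈⟨⟩-∷ (M zero) (tail⊆ l)

  module _ {a n} (M : Fin a → Vector Carrier n) where

    rowBasis-HasRank : HasRank R M (RowBasis.dim (rowBasis M))
    rowBasis-HasRank = (row , independent) , λ s σ indep → steinitz indep (λ i → spanning (σ i))
      where open RowBasis (rowBasis M)

    rank : ∃ (HasRank R M)
    rank = _ , rowBasis-HasRank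

    HasRank-unique : ∀ {d d′} → HasRank R M d → HasRank R M d′ → d ≡ d′
    HasRank-unique ((σ , indep) , maximal) ((σ′ , indep′) , maximal′) =
      ℕ.≤-antisym (maximal′ _ σ indep) (maximal _ σ′ indep′)

    HasRank-≥ : ∀ {f d} {F : Fin f → Vector Carrier n} → LinIndep R F → F ⊆⟨ M ⟩ → HasRank R M d → f ℕ.≤ d
    HasRank-≥ indep F⊆M rk with ≡.refl ← HasRank-unique (rowBasis-HasRank) rk =
      steinitz indep (λ i → ∈⟨⟩-trans (F⊆M i) (RowBasis.spanning (rowBasis M)))

    HasRank-≤ : ∀ {f d} {F : Fin f → Vector Carrier n} → M ⊆⟨ F ⟩ → HasRank R M d → d ℕ.≤ f
    HasRank-≤ M⊆F ((σ , indep) , _) = steinitz indep (λ i → M⊆F (σ i))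

    basis⇒HasRank : ∀ {f} {F : Fin f → Vector Carrier n} → LinIndep R F → F ⊆⟨ M ⟩ → M ⊆⟨ F ⟩ → HasRank R M f
    basis⇒HasRank indep F⊆M M⊆F with rank
    ... | _ , rk with ≡.refl ← ℕ.≤-antisym (HasRank-≥ indep F⊆M rk) (HasRank-≤ M⊆F rk) = rk

  HasRank-transpose-≤ : ∀ {a n d d′} (M : Fin a → Vector Carrier n) →
                        HasRank R M d → HasRank R (transpose M) d′ → d′ ℕ.≤ d
  HasRank-transpose-≤ M rk rkᵀ with ≡.refl ← HasRank-unique M (rowBasis-HasRank M) rk =
    HasRank-≤ (transpose M) Mᵀ⊆ rkᵀ
    where
    open RowBasis (rowBasis M)
    Mᵀ⊆ : transpose M ⊆⟨ (λ i l → proj₁ (spanning l) i) ⟩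
    Mᵀ⊆ j = (λ i → M (row i) j) , λ l →
      trans (proj₂ (spanning l) j) (sum-cong-≋ (λ i → *-comm (proj₁ (spanning l) i) (M (row i) j)))

  HasRank-transpose : ∀ {a n d} (M : Fin a → Vector Carrier n) → HasRank R M d → HasRank R (transpose M) d
  HasRank-transpose M rk with rank (transpose M)
  ... | _ , rkᵀ
    with ≡.refl ← ℕ.≤-antisym (HasRank-transpose-≤ (transpose M) rkᵀ rk) (HasRank-transpose-≤ M rk rkᵀ) = rkᵀ

  HasRank-zeroMatrix : ∀ {a n} (M : Fin a → Vector Carrier n) → (∀ l → M l ≋ 0v) → HasRank R M 0
  HasRank-zeroMatrix M M≋0 = ((λ ()) , λ _ _ ()) , λ s σ indep → steinitz {w = λ ()} indep (λ i → (λ ()) , M≋0 (σ i))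

module ScalarExtension {c ℓ c′ ℓ′} (K : CommutativeRing c ℓ) (L : CommutativeRing c′ ℓ′)
                       (isFieldK : IsField K) (_≟_ : Decidable (CommutativeRing._≈_ K)) (isFieldL : IsField L)
                       (ι : CommutativeRing.Carrier K → CommutativeRing.Carrier L) (embedding : IsEmbedding K L ι) where
  module K = DiscreteField K isFieldK _≟_
  module L = Field L isFieldL
  open RingMorphisms.IsRingMonomorphism embedding

  ιᵛ : ∀ {n} → Vector K.Carrier n → Vector L.Carrier n
  ιᵛ v j = ι (v j)

  ι-sum : ∀ {n} (f : Vector K.Carrier n) → ι (K.sum f) L.≈ L.sum (ιᵛ f)
  ι-sum {zero}  f = 0#-homo
  ι-sum {suc n} f = L.trans (+-homo _ _) (L.+-congˡ (ι-sum (λ i → f (suc i))))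

  ι-lincomb : ∀ {p n} (α : Vector K.Carrier p) (W : Fin p → Vector K.Carrier n) →
              ιᵛ (K.lincomb α W) L.≋ L.lincomb (ιᵛ α) (λ i → ιᵛ (W i))
  ι-lincomb α W j = L.trans (ι-sum (λ i → α i K.* W i j)) (L.sum-cong-≋ (λ i → *-homo (α i) (W i j)))

  ι-sweep : ∀ {n} (v w : Vector K.Carrier n) a → ιᵛ (v K.⊖ a K.⊛ w) L.≋ ιᵛ v L.⊖ ι a L.⊛ ιᵛ w
  ι-sweep v w a j = L.trans (+-homo _ _) (L.+-congˡ (L.trans (-‿homo _) (L.-‿cong (*-homo a (w j)))))

  ιᵛ-0v : ∀ {n} {v : Vector K.Carrier n} → v K.≋ K.0v → ιᵛ v L.≋ L.0v
  ιᵛ-0v v≋0 j = L.trans (⟦⟧-cong (v≋0 j)) 0#-homo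

  ι-≉0 : ∀ {x} → ¬ x K.≈ K.0# → ¬ ι x L.≈ L.0#
  ι-≉0 x≉0 ιx≈0 = x≉0 (injective (L.trans ιx≈0 (L.sym 0#-homo)))

  -- Eliminate along a column where u 0 is non-zero; the elimination happens over K and commutes with ι.
  LinIndep-ι : ∀ {s n} (u : Fin s → Vector K.Carrier n) → LinIndep K u → LinIndep L (λ i → ιᵛ (u i))
  LinIndep-ι {zero} u _ α _ ()
  LinIndep-ι {suc s} u indep with K.≋0v-or-nonzeroEntry (u zero)
  ... | inj₁ u₀≋0 = ⊥-elim (K.LinIndep⇒≉0v u indep zero u₀≋0)
  ... | inj₂ (j₀ , γ≉0) with K.inverse γ≉0
  ... | γ⁻¹ , γγ⁻¹≈1 =
    L.LinIndep-unsweep {v = λ i → ιᵛ (u i)} (λ k → ι (μ k)) j₀ (ι-≉0 γ≉0) ιu′ⱼ₀≈0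
      (L.LinIndep-resp-≋ (λ k → ι-sweep (u (suc k)) (u zero) (μ k))
        (LinIndep-ι u′ (K.LinIndep-sweep {v = u} μ indep)))
    where
    μ : Vector K.Carrier s
    μ k = u (suc k) j₀ K.* γ⁻¹
    u′ = λ k → u (suc k) K.⊖ μ k K.⊛ u zero
    u′ⱼ₀≈0 : ∀ k → u′ k j₀ K.≈ K.0#
    u′ⱼ₀≈0 k = K.trans (K.+-congˡ (K.-‿cong (K.trans (K.*-assoc _ γ⁻¹ _)
                 (K.trans (K.*-congˡ (K.trans (K.*-comm γ⁻¹ _) γγ⁻¹≈1)) (K.*-identityʳ _)))))
               (K.-‿inverseʳ _)
    ιu′ⱼ₀≈0 : ∀ k → ι (u (suc k) j₀) L.- ι (μ k) L.* ι (u zero j₀) L.≈ L.0#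
    ιu′ⱼ₀≈0 k = L.trans (L.sym (ι-sweep (u (suc k)) (u zero) (μ k) j₀)) (L.trans (⟦⟧-cong (u′ⱼ₀≈0 k)) 0#-homo)

  infixr 7 _⋆_

  -- H ⋆ v = H ι(v)ᵀ, so mulT ι H Y is definitionally the transpose of λ l → H ⋆ Y l.
  _⋆_ : ∀ {a b} → Matrix L.Carrier a b → Vector K.Carrier b → Vector L.Carrier a
  (H ⋆ v) i = L.sum (λ j → H i j L.* ι (v j))

  ⋆-cong : ∀ {a b} (H : Matrix L.Carrier a b) {v w} → v K.≋ w → H ⋆ v L.≋ H ⋆ w
  ⋆-cong H v≋w i = L.sum-cong-≋ (λ j → L.*-congˡ (⟦⟧-cong (v≋w j)))

  ⋆≋lincomb : ∀ {a b} (H : Matrix L.Carrier a b) v → H ⋆ v L.≋ L.lincomb (ιᵛ v) (transpose H)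
  ⋆≋lincomb H v i = L.sum-cong-≋ (λ j → L.*-comm (H i j) (ι (v j)))

  ⋆-lincomb : ∀ {a b p} (H : Matrix L.Carrier a b) (α : Vector K.Carrier p) (W : Fin p → Vector K.Carrier b) →
              H ⋆ K.lincomb α W L.≋ L.lincomb (ιᵛ α) (λ i → H ⋆ W i)
  ⋆-lincomb H α W = L.≋-trans (⋆≋lincomb H (K.lincomb α W)) (L.≋-trans
    (L.lincomb-congˡ (transpose H) (ι-lincomb α W)) (L.≋-trans
    (L.≋-sym (L.lincomb-assoc (ιᵛ α) (λ i → ιᵛ (W i)) (transpose H)))
    (L.lincomb-cong L.≋-refl (λ i → L.≋-sym (⋆≋lincomb H (W i))))))

  ⋆-∈⟨⟩ : ∀ {a b p} (H : Matrix L.Carrier a b) {W : Fin p → Vector K.Carrier b} {v} →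
          v K.∈⟨ W ⟩ → H ⋆ v L.∈⟨ (λ i → H ⋆ W i) ⟩
  ⋆-∈⟨⟩ H {W} (α , v≋αW) = ιᵛ α , L.≋-trans (⋆-cong H v≋αW) (⋆-lincomb H α W)

  ⋆-⊕ : ∀ {a b} (H : Matrix L.Carrier a b) v w → H ⋆ (v K.⊕ w) L.≋ H ⋆ v L.⊕ H ⋆ w
  ⋆-⊕ H v w i = L.trans (L.sum-cong-≋ (λ j → L.trans (L.*-congˡ (+-homo (v j) (w j))) (L.distribˡ _ _ _)))
                        (L.∑-distrib-+ (λ j → H i j L.* ι (v j)) (λ j → H i j L.* ι (w j)))

  ι-∈⟨⟩ : ∀ {p n} {U : Fin p → Vector K.Carrier n} {u} → u K.∈⟨ U ⟩ → ιᵛ u L.∈⟨ (λ i → ιᵛ (U i)) ⟩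
  ι-∈⟨⟩ {U = U} (α , u≋αU) = ιᵛ α , λ j → L.trans (⟦⟧-cong (u≋αU j)) (ι-lincomb α U j)

  identity-⋆ : ∀ {n} (u : Vector K.Carrier n) → identity L n ⋆ u L.≋ ιᵛ u
  identity-⋆ u i = L.trans (L.sum-cong-≋ (λ j → L.*-congʳ (L.reflexive (L.identity≡δ i j)))) (L.sum-δ i (ιᵛ u))

  blockDiag-⋆ : ∀ {a₁ b₁ a₂ b₂} (A : Matrix L.Carrier a₁ b₁) (B : Matrix L.Carrier a₂ b₂) v →
                blockDiag L A B ⋆ v L.≋ (A ⋆ (λ j → v (j ↑ˡ b₂))) ++ (B ⋆ (λ j → v (b₁ ↑ʳ j)))
  blockDiag-⋆ {a₁} {b₁} {a₂} {b₂} A B v = ↑-elim a₁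
    (λ i → L.trans (L.sum-split b₁ _) (L.trans (L.+-cong
      (L.sum-cong-≋ (λ j → L.*-congʳ (L.reflexive (L.blockDiag-↑ˡ-↑ˡ A B i j))))
      (L.sum-zero (λ j → L.trans (L.*-congʳ (L.reflexive (L.blockDiag-↑ˡ-↑ʳ A B i j))) (L.zeroˡ _))))
      (L.trans (L.+-identityʳ _) (L.reflexive (≡.sym (lookup-++ˡ (A ⋆ _) (B ⋆ _) i))))))
    (λ i → L.trans (L.sum-split b₁ _) (L.trans (L.+-cong
      (L.sum-zero (λ j → L.trans (L.*-congʳ (L.reflexive (L.blockDiag-↑ʳ-↑ˡ A B i j))) (L.zeroˡ _)))
      (L.sum-cong-≋ (λ j → L.*-congʳ (L.reflexive (L.blockDiag-↑ʳ-↑ʳ A B i j)))))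
      (L.trans (L.+-identityˡ _) (L.reflexive (≡.sym (lookup-++ʳ (A ⋆ _) (B ⋆ _) i))))))

module _ (t v d₁ d₂ x : ℕ) where
  open +-*-Solver

  private
    +t≡ : + t ≡ + (t ℕ.+ x) ℤ.- + x
    +t≡ rewrite ℤ.pos-+ t x = solve 2 (λ t x → t := (t :+ x) :- x) ≡.refl (+ t) (+ x)

    +v+[d₁+d₂-x]≡ : + (v ℕ.+ (d₁ ℕ.+ d₂)) ℤ.- + x ≡ + v ℤ.+ ((+ d₁ ℤ.+ + d₂) ℤ.- + x)
    +v+[d₁+d₂-x]≡ rewrite ℤ.pos-+ v (d₁ ℕ.+ d₂) | ℤ.pos-+ d₁ d₂ =
      solve 4 (λ v d₁ d₂ x → (v :+ (d₁ :+ d₂)) :- x := v :+ ((d₁ :+ d₂) :- x)) ≡.refl (+ v) (+ d₁) (+ d₂) (+ x)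

  +-difference-≡ : t ℕ.+ x ≡ v ℕ.+ (d₁ ℕ.+ d₂) → + t ≡ + v ℤ.+ ((+ d₁ ℤ.+ + d₂) ℤ.- + x)
  +-difference-≡ eq = ≡.trans +t≡ (≡.trans (≡.cong (λ n → + n ℤ.- + x) eq) +v+[d₁+d₂-x]≡)

  +-difference-≤ : t ℕ.+ x ℕ.≤ v ℕ.+ (d₁ ℕ.+ d₂) → + t ℤ.≤ + v ℤ.+ ((+ d₁ ℤ.+ + d₂) ℤ.- + x)
  +-difference-≤ le = ℤ.≤-trans (ℤ.≤-reflexive +t≡)
    (ℤ.≤-trans (ℤ.+-monoˡ-≤ (ℤ.- + x) (ℤ.+≤+ le)) (ℤ.≤-reflexive +v+[d₁+d₂-x]≡))

module DirectSumRank {c ℓ c′ ℓ′} (K : CommutativeRing c ℓ) (L : CommutativeRing c′ ℓ′) {q q′}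
                     (isFieldK : IsField K) (cardK : HasCardinality K q)
                     (isFieldL : IsField L) (cardL : HasCardinality L q′)
                     (ι : CommutativeRing.Carrier K → CommutativeRing.Carrier L) (embedding : IsEmbedding K L ι)
                     (n₁ n₂ k₂ : ℕ) (G₂ : Matrix (CommutativeRing.Carrier L) k₂ n₂) where
  module K = FiniteField K isFieldK cardK
  module L = FiniteField L isFieldL cardL
  open DirectSum K L ι n₁ n₂ k₂ G₂ using (Values; In𝒳₀; f; Rank⊕)
  open ScalarExtension K L isFieldK K._≟_ isFieldL ι embedding
    using (ιᵛ; ιᵛ-0v; LinIndep-ι; ι-∈⟨⟩; _⋆_; ⋆-cong; ⋆-∈⟨⟩; ⋆-⊕; identity-⋆; blockDiag-⋆)

  G : Matrix L.Carrier (n₁ ℕ.+ k₂) (n₁ ℕ.+ n₂)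
  G = blockDiag L (identity L n₁) G₂

  G⋆-split : ∀ v → G ⋆ v L.≋ ιᵛ (λ j → v (j ↑ˡ n₂)) ++ (G₂ ⋆ (λ j → v (n₁ ↑ʳ j)))
  G⋆-split v = L.≋-trans (blockDiag-⋆ (identity L n₁) G₂ v) (L.++⁺ L._≈_ {m = n₁} (identity-⋆ _) L.≋-refl)

  G⋆-↑ˡ : ∀ v i → (G ⋆ v) (i ↑ˡ k₂) L.≈ ι (v (i ↑ˡ n₂))
  G⋆-↑ˡ v i = L.trans (G⋆-split v (i ↑ˡ k₂)) (L.reflexive (lookup-++ˡ (ιᵛ _) (G₂ ⋆ _) i))

  G⋆-↑ʳ : ∀ v i → (G ⋆ v) (n₁ ↑ʳ i) L.≈ (G₂ ⋆ (λ j → v (n₁ ↑ʳ j))) i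
  G⋆-↑ʳ v i = L.trans (G⋆-split v (n₁ ↑ʳ i)) (L.reflexive (lookup-++ʳ (ιᵛ (λ j → v (j ↑ˡ n₂))) (G₂ ⋆ _) i))

  module _ {r} (Y : Matrix K.Carrier r (n₁ ℕ.+ n₂)) where

    Φ : Fin r → Vector L.Carrier (n₁ ℕ.+ k₂)
    Φ l = G ⋆ Y l

    open K.RowBasis (K.rowBasis (π₁ {n₁ = n₁} Y))
      renaming (dim to a; row to σ; independent to π₁Yσ-independent; spanning to π₁Y⊆π₁Yσ)

    Yσ : Fin a → Vector K.Carrier (n₁ ℕ.+ n₂)
    Yσ i = Y (σ i)

    coeff : Fin r → Vector K.Carrier a
    coeff l = proj₁ (π₁Y⊆π₁Yσ l)

    -- The rows of Z = A Y span X₀ = V ∩ ker π₁.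
    A : Matrix K.Carrier r r
    A l = K.δ l K.⊖ K.lincomb (coeff l) (λ i → K.δ (σ i))

    Z : Matrix K.Carrier r (n₁ ℕ.+ n₂)
    Z = _⊙_ K A Y

    Z≋ : ∀ l → Z l K.≋ Y l K.⊖ K.lincomb (coeff l) Yσ
    Z≋ l = K.≋-trans (K.lincomb-- (K.δ l) (K.lincomb (coeff l) (λ i → K.δ (σ i))) Y) λ j → K.+-cong (K.lincomb-δ l Y j)
      (K.-‿cong (K.trans (K.sym (K.lincomb-assoc (coeff l) (λ i → K.δ (σ i)) Y j))
                         (K.lincomb-cong K.≋-refl (λ i → K.lincomb-δ (σ i) Y) j)))

    π₁Z≋0 : ∀ l → π₁ {n₁ = n₁} Z l K.≋ K.0v
    π₁Z≋0 l i = K.trans (Z≋ l (i ↑ˡ n₂)) (K.trans (K.+-congˡ (K.-‿cong (K.sym (proj₂ (π₁Y⊆π₁Yσ l) i))))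
                                                 (K.-‿inverseʳ _))

    Y≋Z⊕ : ∀ l → Y l K.≋ Z l K.⊕ K.lincomb (coeff l) Yσ
    Y≋Z⊕ l j = K.sym (K.trans (K.+-congʳ (Z≋ l j)) (K.//-rightDividesˡ _ _))

    Z⊆Y : Z K.⊆⟨ Y ⟩
    Z⊆Y l = A l , K.≋-refl

    open K.RowBasis (K.rowBasis Z)
      renaming (dim to b; row to τ; independent to Zτ-independent; spanning to Z⊆Zτ)

    Ψ : Fin r → Vector L.Carrier k₂
    Ψ l = G₂ ⋆ π₂ {n₁ = n₁} Z l

    open L.RowBasis (L.rowBasis Ψ)
      renaming (dim to d₂; row to ϱ; independent to Ψϱ-independent; spanning to Ψ⊆Ψϱ)

    G⋆Z≋ : ∀ l → G ⋆ Z l L.≋ L.0v ++ Ψ l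
    G⋆Z≋ l = L.≋-trans (G⋆-split (Z l)) (L.++⁺ L._≈_ {m = n₁} (ιᵛ-0v (π₁Z≋0 l)) L.≋-refl)

    Yσ++Zτ : Fin (a ℕ.+ b) → Vector K.Carrier (n₁ ℕ.+ n₂)
    Yσ++Zτ = Yσ ++ (λ i → Z (τ i))

    Yσ++Zτ-independent : LinIndep K Yσ++Zτ
    Yσ++Zτ-independent = K.LinIndep-++ (_↑ˡ n₂) π₁Yσ-independent (λ i → π₁Z≋0 (τ i)) Zτ-independent

    Y⊆Yσ++Zτ : Y K.⊆⟨ Yσ++Zτ ⟩
    Y⊆Yσ++Zτ l = K.∈⟨⟩-respˡ-≋ (K.≋-sym (Y≋Z⊕ l))
      (K.∈⟨⟩-⊕ (K.∈⟨⟩-++ʳ Yσ (Z⊆Zτ l)) (K.∈⟨⟩-++ˡ _ (coeff l , K.≋-refl)))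

    Yσ++Zτ⊆Y : Yσ++Zτ K.⊆⟨ Y ⟩
    Yσ++Zτ⊆Y = K.⊆⟨⟩-++ (K.⊆⟨⟩-refl Y ∘ σ) (Z⊆Y ∘ τ)

    dimV : HasRank K Y (a ℕ.+ b)
    dimV = K.basis⇒HasRank Y Yσ++Zτ-independent Yσ++Zτ⊆Y Y⊆Yσ++Zτ

    Φσ++G⋆Zϱ : Fin (a ℕ.+ d₂) → Vector L.Carrier (n₁ ℕ.+ k₂)
    Φσ++G⋆Zϱ = (λ i → Φ (σ i)) ++ (λ i → G ⋆ Z (ϱ i))

    Φσ++G⋆Zϱ-independent : LinIndep L Φσ++G⋆Zϱ
    Φσ++G⋆Zϱ-independent = L.LinIndep-++ (_↑ˡ k₂)
      (L.LinIndep-resp-≋ (λ i j → L.sym (G⋆-↑ˡ (Yσ i) j)) (LinIndep-ι _ π₁Yσ-independent))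
      (λ i j → L.trans (G⋆Z≋ (ϱ i) (j ↑ˡ k₂)) (L.reflexive (lookup-++ˡ L.0v (Ψ (ϱ i)) j)))
      (L.LinIndep-restrict (n₁ ↑ʳ_) (L.LinIndep-resp-≋ (λ i j → L.sym (G⋆-↑ʳ (Z (ϱ i)) j)) Ψϱ-independent))

    Φ⊆Φσ++G⋆Zϱ : Φ L.⊆⟨ Φσ++G⋆Zϱ ⟩
    Φ⊆Φσ++G⋆Zϱ l = L.∈⟨⟩-respˡ-≋ (L.≋-sym (L.≋-trans (⋆-cong G (Y≋Z⊕ l)) (⋆-⊕ G (Z l) _)))
      (L.∈⟨⟩-⊕ (L.∈⟨⟩-++ʳ _ G⋆Zₗ∈) (L.∈⟨⟩-++ˡ _ (⋆-∈⟨⟩ G (coeff l , K.≋-refl))))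
      where
      G⋆Zₗ∈ : G ⋆ Z l L.∈⟨ (λ i → G ⋆ Z (ϱ i)) ⟩
      G⋆Zₗ∈ = L.∈⟨⟩-respʳ-≋ (λ i → L.≋-sym (G⋆Z≋ (ϱ i)))
                (L.∈⟨⟩-respˡ-≋ (L.≋-sym (G⋆Z≋ l)) (L.∈⟨⟩-padˡ (Ψ⊆Ψϱ l)))

    Φσ++G⋆Zϱ⊆Φ : Φσ++G⋆Zϱ L.⊆⟨ Φ ⟩
    Φσ++G⋆Zϱ⊆Φ = L.⊆⟨⟩-++ (L.⊆⟨⟩-refl Φ ∘ σ) (λ i → ⋆-∈⟨⟩ G (Z⊆Y (ϱ i)))

    rankΦ : HasRank L Φ (a ℕ.+ d₂)
    rankΦ = L.basis⇒HasRank Φ Φσ++G⋆Zϱ-independent Φσ++G⋆Zϱ⊆Φ Φ⊆Φσ++G⋆Zϱ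

    d₂≤b : d₂ ℕ.≤ b
    d₂≤b = L.HasRank-≤ Ψ (λ l → ⋆-∈⟨⟩ G₂ (K.∈⟨⟩-restrict (n₁ ↑ʳ_) (Z⊆Zτ l))) (L.rowBasis-HasRank Ψ)

    module _ {s} (A′ : Matrix K.Carrier s r) where

      X : Matrix K.Carrier s (n₁ ℕ.+ n₂)
      X = _⊙_ K A′ Y

      open K.RowBasis (K.rowBasis X) renaming (dim to dX; row to ξ; independent to Xξ-independent)
      open K.BasisExtension (K.extendBasis Y Xξ-independent)
        renaming (size to e; row to υ; independent to Yυ++Xξ-independent; spanning to Y⊆Yυ++Xξ)

      e+dX≤dimV : e ℕ.+ dX ℕ.≤ a ℕ.+ b
      e+dX≤dimV =
        K.HasRank-≥ Y Yυ++Xξ-independent (K.⊆⟨⟩-++ (K.⊆⟨⟩-refl Y ∘ υ) (λ i → A′ (ξ i) , K.≋-refl)) dimV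

      open K.RowBasis (K.rowBasis (π₁ {n₁ = n₁} X)) renaming (dim to d₁; row to ζ; spanning to π₁X⊆π₁Xζ)

      Ψ′ : Fin s → Vector L.Carrier k₂
      Ψ′ l = G₂ ⋆ π₂ {n₁ = n₁} X l

      open L.RowBasis (L.rowBasis Ψ′) renaming (dim to d₂′; row to θ; spanning to Ψ′⊆Ψ′θ)

      Q : Fin (d₁ ℕ.+ d₂′) → Vector L.Carrier (n₁ ℕ.+ k₂)
      Q = (λ i → ιᵛ (π₁ {n₁ = n₁} X (ζ i)) ++ L.0v) ++ (λ i → L.0v ++ Ψ′ (θ i))

      G⋆X⊆Q : (λ l → G ⋆ X l) L.⊆⟨ Q ⟩
      G⋆X⊆Q l = L.∈⟨⟩-respˡ-≋ (L.≋-sym (G⋆-split (X l)))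
                  (L.∈⟨⟩-++-blocks (ι-∈⟨⟩ (π₁X⊆π₁Xζ l)) (Ψ′⊆Ψ′θ l))

      Φ⊆Φυ++Q : Φ L.⊆⟨ (λ i → Φ (υ i)) ++ Q ⟩
      Φ⊆Φυ++Q l = L.∈⟨⟩-trans (⋆-∈⟨⟩ G (Y⊆Yυ++Xξ l))
        (++-all {P = λ v → G ⋆ v L.∈⟨ (λ i → Φ (υ i)) ++ Q ⟩}
          (λ i → L.∈⟨⟩-++ˡ Q (L.⊆⟨⟩-refl _ i)) (λ i → L.∈⟨⟩-++ʳ (λ i → Φ (υ i)) (G⋆X⊆Q (ξ i))))

      rankΦ≤ : a ℕ.+ d₂ ℕ.≤ e ℕ.+ (d₁ ℕ.+ d₂′)
      rankΦ≤ = L.HasRank-≤ Φ Φ⊆Φυ++Q rankΦ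

      rank-bound : ∀ {d₁″ d₂″ dX″} → Values X d₁″ d₂″ dX″ →
                   (a ℕ.+ d₂) ℕ.+ dX″ ℕ.≤ (a ℕ.+ b) ℕ.+ (d₁″ ℕ.+ d₂″)
      rank-bound (rk₁ , rk₂ , rkX)
        with ≡.refl ← K.HasRank-unique X (K.rowBasis-HasRank X) rkX
           | ≡.refl ← K.HasRank-unique (π₁ {n₁ = n₁} X) (K.rowBasis-HasRank (π₁ {n₁ = n₁} X)) rk₁
           | ≡.refl ← L.HasRank-unique (transpose Ψ′) (L.HasRank-transpose Ψ′ (L.rowBasis-HasRank Ψ′)) rk₂
        = begin
          (a ℕ.+ d₂) ℕ.+ dX               ≤⟨ ℕ.+-monoˡ-≤ dX rankΦ≤ ⟩
          (e ℕ.+ (d₁ ℕ.+ d₂′)) ℕ.+ dX     ≡⟨ xy∙z≈xz∙y e _ dX ⟩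
          (e ℕ.+ dX) ℕ.+ (d₁ ℕ.+ d₂′)     ≤⟨ ℕ.+-monoˡ-≤ _ e+dX≤dimV ⟩
          (a ℕ.+ b) ℕ.+ (d₁ ℕ.+ d₂′)      ∎
        where open ℕ.≤-Reasoning

    rank-GYᵀ : RankG K L ι G Y (a ℕ.+ d₂)
    rank-GYᵀ = L.HasRank-transpose Φ rankΦ

    -- The bound holds for every X ≤ V, not only for X ∈ 𝒳₀.
    rank⊕-minimal : ∀ s (A′ : Matrix K.Carrier s r) d₁ d₂′ dX →
                    Values (_⊙_ K A′ Y) d₁ d₂′ dX → In𝒳₀ (_⊙_ K A′ Y) d₁ d₂′ dX →
                    + (a ℕ.+ d₂) ℤ.≤ + (a ℕ.+ b) ℤ.+ f d₁ d₂′ dX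
    rank⊕-minimal s A′ d₁ d₂′ dX values _ = +-difference-≤ _ _ d₁ d₂′ dX (rank-bound A′ values)

    Z-values : Values Z 0 d₂ b
    Z-values = K.HasRank-zeroMatrix (π₁ {n₁ = n₁} Z) π₁Z≋0 ,
               L.HasRank-transpose Ψ (L.rowBasis-HasRank Ψ) ,
               K.rowBasis-HasRank Z

    A∅ : Matrix K.Carrier 0 r
    A∅ ()

    X∅ : Matrix K.Carrier 0 (n₁ ℕ.+ n₂)
    X∅ = _⊙_ K A∅ Y

    X∅-values : Values X∅ 0 0 0
    X∅-values = K.HasRank-zeroMatrix (π₁ {n₁ = n₁} X∅) (λ ()) ,
                L.HasRank-zeroMatrix (mulT K L ι G₂ (π₂ {n₁ = n₁} X∅)) (λ _ ()) ,
                K.HasRank-zeroMatrix X∅ (λ ())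

    rank⊕ : Rank⊕ Y (a ℕ.+ d₂)
    rank⊕ with d₂ ℕ.<? b
    ... | yes d₂<b = a ℕ.+ b , dimV ,
      (r , A , 0 , d₂ , b , Z-values , inj₂ (lift d₂<b) , +-difference-≡ _ _ 0 d₂ b (xy∙z≈xz∙y a d₂ b)) ,
      rank⊕-minimal
    ... | no d₂≮b = a ℕ.+ b , dimV ,
      (0 , A∅ , 0 , 0 , 0 , X∅-values , inj₁ (λ ()) ,
       +-difference-≡ _ _ 0 0 0 (≡.cong (λ x → (a ℕ.+ x) ℕ.+ 0) (ℕ.≤-antisym d₂≤b (ℕ.≮⇒≥ d₂≮b)))) ,
      rank⊕-minimal

open import Data.Nat using (ℕ; _+_; _^_)
open import Data.Product using (Σ; _×_)

proposition3p9 : ∀ {c ℓ c′ ℓ′} (K : CommutativeRing c ℓ) (L : CommutativeRing c′ ℓ′)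
    (q m : ℕ) → IsField K → HasCardinality K q → IsField L → HasCardinality L (q ^ m) →
    (ι : CommutativeRing.Carrier K → CommutativeRing.Carrier L) → IsEmbedding K L ι →
    (n₁ n₂ k₂ : ℕ) (G₂ : Matrix (CommutativeRing.Carrier L) k₂ n₂) →
    ∀ r (Y : Matrix (CommutativeRing.Carrier K) r (n₁ + n₂)) →
    Σ ℕ λ t → RankG K L ι (blockDiag L (identity L n₁) G₂) Y t
      × DirectSum.Rank⊕ K L ι n₁ n₂ k₂ G₂ Y t
proposition3p9 K L q m isFieldK cardK isFieldL cardL ι embedding n₁ n₂ k₂ G₂ r Y =
  _ , rank-GYᵀ Y , rank⊕ Y
  where open DirectSumRank K L isFieldK cardK isFieldL cardL ι embedding n₁ n₂ k₂ G₂
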